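{- For $n\ge1$ and $k\ge 0$, let $\mathcal{P}_{n,k}$ be the set of $\sigma\in\mathfrak{S}_n$ with $\widetilde{\mathrm{M}}(\sigma)=k$. Then $$\sum_{\sigma\in\mathcal{P}_{n,k}}(2\alpha)^{\mathrm{lmi}(\sigma)-1}(2\beta)^{\mathrm{rmi}(\sigma)-1}=\sum_{\sigma\in\mathcal{P}_{n,k}}(\alpha+\beta)^{\mathrm{lmi}(\sigma)+\mathrm{rmi}(\sigma)-2}.$$
   Context: $\mathfrak{S}_n$ is the set of permutations $\sigma=\sigma_1\cdots\sigma_n$ of $[n]$. $\widetilde{\mathrm{M}}(\sigma)$ is the number of indices $i\in[n]$ with $\sigma_{i-1}<\sigma_i>\sigma_{i+1}$ under the boundary convention $\sigma_0=\sigma_{n+1}=+\infty$. $\mathrm{lmi}(\sigma)$ (resp. $\mathrm{rmi}(\sigma)$) is the number of left-to-right minima (resp. right-to-left minima) of $\sigma$, i.e. entries $\sigma_i$ smaller than all entries to their left (resp. right). $\alpha,\beta$ are indeterminates. -}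

module Defs where

open import Data.Nat using (ℕ; zero; suc; _<ᵇ_) renaming (_∸_ to _∸ℕ_; _+_ to _+ℕ_)
open import Data.Bool using (Bool; true; false; _∧_; if_then_else_)
open import Data.List using (List; []; _∷_; [_]; _++_; map; concatMap; reverse; length; filterᵇ; upTo)
open import Data.Nat using (_≡ᵇ_)
open import Level using (Level)
open import Algebra.Bundles using (CommutativeSemiring)

insertEverywhere : ℕ → List ℕ → List (List ℕ)
insertEverywhere x []       = [ x ∷ [] ]
insertEverywhere x (y ∷ ys) = (x ∷ y ∷ ys) ∷ map (y ∷_) (insertEverywhere x ys)

-- 𝔖 n : all permutations σ₁⋯σₙ of [n] = {1,…,n}, in one-line notation
-- (each permutation listed exactly once).
𝔖 : ℕ → List (List ℕ)
𝔖 zero    = [ [] ]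
𝔖 (suc n) = concatMap (insertEverywhere (suc n)) (𝔖 n)

-- Extended naturals, used for the boundary convention σ₀ = σₙ₊₁ = +∞.
data ℕ∞ : Set where
  fin : ℕ → ℕ∞
  ∞   : ℕ∞

_<∞ᵇ_ : ℕ∞ → ℕ∞ → Bool
fin m <∞ᵇ fin n = m <ᵇ n
fin m <∞ᵇ ∞     = true
∞     <∞ᵇ _     = false

peaksIn : List ℕ∞ → ℕ
peaksIn (a ∷ b ∷ c ∷ rest) =
  (if (a <∞ᵇ b) ∧ (c <∞ᵇ b) then 1 else 0) +ℕ peaksIn (b ∷ c ∷ rest)
peaksIn _ = 0

Mtilde : List ℕ → ℕ
Mtilde σ = peaksIn (∞ ∷ map fin σ ++ [ ∞ ])

allAbove : ℕ → List ℕ → Bool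
allAbove m []       = true
allAbove m (x ∷ xs) = (m <ᵇ x) ∧ allAbove m xs

rmi : List ℕ → ℕ
rmi []       = 0
rmi (x ∷ xs) = (if allAbove x xs then 1 else 0) +ℕ rmi xs

lmi : List ℕ → ℕ
lmi σ = rmi (reverse σ)

𝒫 : ℕ → ℕ → List (List ℕ)
𝒫 n k = filterᵇ (λ σ → Mtilde σ ≡ᵇ k) (𝔖 n)

module _ {c ℓ : Level} (R : CommutativeSemiring c ℓ) where
  open CommutativeSemiring R
  open import Algebra.Definitions.RawSemiring rawSemiring using (_^_)

  Σ[_]_ : List (List ℕ) → (List ℕ → Carrier) → Carrier
  Σ[ [] ] f     = 0#
  Σ[ σ ∷ σs ] f = f σ + Σ[ σs ] f

  lhsSum : ℕ → ℕ → Carrier → Carrier → Carrier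
  lhsSum n k α β = Σ[ 𝒫 n k ] (λ σ → ((α + α) ^ (lmi σ ∸ℕ 1)) * ((β + β) ^ (rmi σ ∸ℕ 1)))

  rhsSum : ℕ → ℕ → Carrier → Carrier → Carrier
  rhsSum n k α β = Σ[ 𝒫 n k ] (λ σ → (α + β) ^ (lmi σ +ℕ rmi σ ∸ℕ 2))

module Submission where

-- Every σ ∈ 𝔖ₙ₊₁ arises by inserting n + 1 into some τ ∈ 𝔖ₙ. Inserting it at the front
-- multiplies u^(lmi − 1) v^(rmi − 1) by u, at the end by v, and keeps M̃; inserting it
-- into one of the n − 1 interior gaps keeps lmi and rmi and raises M̃ by one unless the gap
-- is next to one of the M̃(τ) peaks, which block exactly 2 M̃(τ) gaps. So for every
-- coefficient sequence f the sums Sₙ(f) = Σ_σ f(M̃ σ) u^(lmi σ − 1) v^(rmi σ − 1) satisfy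
-- Sₙ₊₁(f) = (u + v) Sₙ(f) + Sₙ(f′) with f′ depending only on f and n, and by induction
-- Sₙ depends on u, v only through u + v. Take f the indicator of k and compare
-- (u, v) = (2α, 2β) with (α + β, α + β).

open import Defs
open import Data.Nat using (ℕ; zero; suc; _≥_; _∸_; _≡ᵇ_) renaming (_+_ to _+ℕ_)
open import Algebra.Bundles using (CommutativeSemiring)
open import Level using (Level)
import Algebra.Properties.CommutativeSemigroup as CommutativeSemigroupProperties
import Relation.Binary.Reasoning.Setoid as SetoidReasoning

module Insertion where
  open import Data.Bool using (Bool; true; false; not; _∧_; _∨_; if_then_else_)
  open import Data.Bool.Properties using (∧-zeroʳ)
  open import Data.Nat using (_+_; _≤_; _<_; _<ᵇ_; _<?_; z<s)
  open import Data.Nat.Properties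
    using (<ᵇ-reflects-<; ≤⇒≯; <⇒≤; ≮⇒≥; +-suc; m+n∸n≡m; <-≤-trans; m≤n+m; ≤-refl; m≤n⇒m≤1+n)
  open import Data.Empty using (⊥-elim)
  open import Data.List using (List; []; _∷_; [_]; _++_; map; reverse; length)
  open import Data.List.Properties
    using (map-++; map-∘; map-cong; ++-assoc; ++-identityʳ; reverse-++; unfold-reverse; reverse-injective)
  open import Data.List.Relation.Unary.All as All using (All; []; _∷_)
  open import Data.List.Relation.Unary.All.Properties using (map⁺; concat⁺; ++⁻)
  open import Data.List.Relation.Binary.Permutation.Propositional using (↭-sym)
  open import Data.List.Relation.Binary.Permutation.Propositional.Properties using (All-resp-↭; ↭-reverse)
  open import Data.Product using (_×_; _,_)
  open import Relation.Nullary using (yes; no)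
  open import Relation.Nullary.Reflects using (ofʸ; ofⁿ; det)
  open import Relation.Binary.PropositionalEquality hiding ([_])
  open ≡-Reasoning

  <ᵇ-true : ∀ {m n} → m < n → (m <ᵇ n) ≡ true
  <ᵇ-true {m} {n} m<n = det (<ᵇ-reflects-< m n) (ofʸ m<n)

  <ᵇ-false : ∀ {m n} → n ≤ m → (m <ᵇ n) ≡ false
  <ᵇ-false {m} {n} n≤m = det (<ᵇ-reflects-< m n) (ofⁿ (≤⇒≯ n≤m))

  bit : Bool → ℕ
  bit b = if b then 1 else 0

  peaksAfter : ℕ∞ → List ℕ → ℕ
  peaksAfter l σ = peaksIn (l ∷ map fin σ ++ [ ∞ ])

  head∞ : List ℕ → ℕ∞
  head∞ []      = ∞
  head∞ (z ∷ _) = fin z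

  isPeak : ℕ∞ → ℕ → List ℕ → Bool
  isPeak l y ys = (l <∞ᵇ fin y) ∧ (head∞ ys <∞ᵇ fin y)

  peaksAfter-∷ : ∀ l y ys → peaksAfter l (y ∷ ys) ≡ bit (isPeak l y ys) + peaksAfter (fin y) ys
  peaksAfter-∷ l y []      = refl
  peaksAfter-∷ l y (_ ∷ _) = refl

  peaks-nonadjacent : ∀ l y z zs → isPeak l y (z ∷ zs) ∧ isPeak (fin y) z zs ≡ false
  peaks-nonadjacent l y z zs with y <? z
  ... | yes y<z rewrite <ᵇ-false (<⇒≤ y<z) | ∧-zeroʳ (l <∞ᵇ fin y) = refl
  ... | no  y≮z rewrite <ᵇ-false (≮⇒≥ y≮z) = ∧-zeroʳ (isPeak l y (z ∷ zs))

  peaksAfter-larger : ∀ {x y} ys → y < x → peaksAfter (fin x) (y ∷ ys) ≡ peaksAfter ∞ (y ∷ ys)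
  peaksAfter-larger {x} {y} ys y<x
    rewrite peaksAfter-∷ (fin x) y ys | peaksAfter-∷ ∞ y ys | <ᵇ-false (<⇒≤ y<x) = refl

  peaksAfter-insertMax : ∀ l {x y z} zs → y < x → z < x → peaksAfter l (y ∷ x ∷ z ∷ zs) ≡ suc (peaksAfter (fin z) zs)
  peaksAfter-insertMax l {x} {y} {z} zs y<x z<x
    rewrite <ᵇ-false (<⇒≤ y<x) | ∧-zeroʳ (l <∞ᵇ fin y) | <ᵇ-true y<x | <ᵇ-true z<x
          | peaksAfter-larger zs z<x | peaksAfter-∷ ∞ z zs = refl

  insertNotLast : ℕ → List ℕ → List (List ℕ)
  insertNotLast x []       = []
  insertNotLast x (y ∷ ys) = (x ∷ y ∷ ys) ∷ map (y ∷_) (insertNotLast x ys)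

  insertEverywhere-insertNotLast : ∀ x σ → insertEverywhere x σ ≡ insertNotLast x σ ++ [ σ ++ [ x ] ]
  insertEverywhere-insertNotLast x []       = refl
  insertEverywhere-insertNotLast x (y ∷ ys) = cong ((x ∷ y ∷ ys) ∷_) (begin
    map (y ∷_) (insertEverywhere x ys)                   ≡⟨ cong (map (y ∷_)) (insertEverywhere-insertNotLast x ys) ⟩
    map (y ∷_) (insertNotLast x ys ++ [ ys ++ [ x ] ])   ≡⟨ map-++ (y ∷_) (insertNotLast x ys) _ ⟩
    map (y ∷_) (insertNotLast x ys) ++ [ y ∷ ys ++ [ x ] ] ∎)

  -- Entry i says whether inserting a new maximum into the i-th gap of y ∷ ys raises the
  -- peak count: the maximum is always a peak, and it destroys one exactly when the gap
  -- is next to a peak.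
  gapGains : ℕ∞ → ℕ → List ℕ → List Bool
  gapGains l y []       = []
  gapGains l y (z ∷ zs) = not (isPeak l y (z ∷ zs) ∨ isPeak (fin y) z zs) ∷ gapGains (fin y) z zs

  peak-moves-or-appears : ∀ a b r → a ∧ b ≡ false → suc r ≡ bit (not (a ∨ b)) + (bit a + (bit b + r))
  peak-moves-or-appears true  true  r ()
  peak-moves-or-appears true  false r _ = refl
  peak-moves-or-appears false true  r _ = refl
  peak-moves-or-appears false false r _ = refl

  peaksAfter-insertNotLast : ∀ l {x} y ys → All (_< x) (y ∷ ys) →
    map (λ t → peaksAfter l (y ∷ t)) (insertNotLast x ys) ≡
    map (λ g → bit g + peaksAfter l (y ∷ ys)) (gapGains l y ys)
  peaksAfter-insertNotLast l y []                 _                    = refl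
  peaksAfter-insertNotLast l {x} y (z ∷ zs) below@(y<x ∷ z<x ∷ _) = cong₂ _∷_ atFront later
    where
    a b : Bool
    a = isPeak l y (z ∷ zs)
    b = isPeak (fin y) z zs
    m : ℕ
    m = peaksAfter (fin y) (z ∷ zs)
    atFront : peaksAfter l (y ∷ x ∷ z ∷ zs) ≡ bit (not (a ∨ b)) + peaksAfter l (y ∷ z ∷ zs)
    atFront = begin
      peaksAfter l (y ∷ x ∷ z ∷ zs)                                   ≡⟨ peaksAfter-insertMax l zs y<x z<x ⟩
      suc (peaksAfter (fin z) zs)
        ≡⟨ peak-moves-or-appears a b _ (peaks-nonadjacent l y z zs) ⟩
      bit (not (a ∨ b)) + (bit a + (bit b + peaksAfter (fin z) zs))
        ≡⟨ cong (λ p → bit (not (a ∨ b)) + (bit a + p)) (peaksAfter-∷ (fin y) z zs) ⟨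
      bit (not (a ∨ b)) + peaksAfter l (y ∷ z ∷ zs)                   ∎
    shift : ∀ g → bit a + (bit g + m) ≡ bit g + (bit a + m)
    shift true  = +-suc (bit a) m
    shift false = refl
    later : map (λ t → peaksAfter l (y ∷ t)) (map (z ∷_) (insertNotLast x zs)) ≡
            map (λ g → bit g + peaksAfter l (y ∷ z ∷ zs)) (gapGains (fin y) z zs)
    later = begin
      map (λ t → peaksAfter l (y ∷ t)) (map (z ∷_) (insertNotLast x zs))    ≡⟨ map-∘ (insertNotLast x zs) ⟨
      map (λ t → bit a + peaksAfter (fin y) (z ∷ t)) (insertNotLast x zs)    ≡⟨ map-∘ (insertNotLast x zs) ⟩
      map (bit a +_) (map (λ t → peaksAfter (fin y) (z ∷ t)) (insertNotLast x zs))
        ≡⟨ cong (map (bit a +_)) (peaksAfter-insertNotLast (fin y) z zs (All.tail below)) ⟩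
      map (bit a +_) (map (λ g → bit g + m) (gapGains (fin y) z zs))         ≡⟨ map-∘ (gapGains (fin y) z zs) ⟨
      map (λ g → bit a + (bit g + m)) (gapGains (fin y) z zs)                ≡⟨ map-cong shift (gapGains (fin y) z zs) ⟩
      map (λ g → bit g + (bit a + m)) (gapGains (fin y) z zs)                ∎

  trues falses : List Bool → ℕ
  trues []           = 0
  trues (true ∷ bs)  = suc (trues bs)
  trues (false ∷ bs) = trues bs
  falses []           = 0
  falses (true ∷ bs)  = falses bs
  falses (false ∷ bs) = suc (falses bs)

  trues+falses≡length : ∀ bs → trues bs + falses bs ≡ length bs
  trues+falses≡length []           = refl
  trues+falses≡length (true ∷ bs)  = cong suc (trues+falses≡length bs)
  trues+falses≡length (false ∷ bs) = trans (+-suc (trues bs) (falses bs)) (cong suc (trues+falses≡length bs))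

  length-gapGains : ∀ l y ys → length (gapGains l y ys) ≡ length ys
  length-gapGains l y []       = refl
  length-gapGains l y (z ∷ zs) = cong suc (length-gapGains (fin y) z zs)

  -- Each peak of y ∷ ys blocks the gaps on both of its sides; only a peak at y itself
  -- has a gap (to l) that is not in the list.
  falses-gapGains : ∀ l y ys → bit (isPeak l y ys) + falses (gapGains l y ys) ≡ peaksAfter l (y ∷ ys) + peaksAfter l (y ∷ ys)
  falses-gapGains l y [] with l <∞ᵇ fin y
  ... | true  = refl
  ... | false = refl
  falses-gapGains l y (z ∷ zs) =
    count (isPeak l y (z ∷ zs)) (isPeak (fin y) z zs) (peaks-nonadjacent l y z zs) (falses-gapGains (fin y) z zs)
    where
    count : ∀ a b {G q} → a ∧ b ≡ false → bit b + falses G ≡ q + q →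
            bit a + falses (not (a ∨ b) ∷ G) ≡ (bit a + q) + (bit a + q)
    count true  true  ()
    count true  false {q = q} _ ih = cong suc (trans (cong suc ih) (sym (+-suc q q)))
    count false true  _ ih = ih
    count false false _ ih = ih

  trues-gapGains : ∀ y ys → trues (gapGains ∞ y ys) ≡ length ys ∸ (Mtilde (y ∷ ys) + Mtilde (y ∷ ys))
  trues-gapGains y ys = begin
    trues G                            ≡⟨ m+n∸n≡m (trues G) (falses G) ⟨
    trues G + falses G ∸ falses G
      ≡⟨ cong₂ _∸_ (trans (trues+falses≡length G) (length-gapGains ∞ y ys)) (falses-gapGains ∞ y ys) ⟩
    length ys ∸ (Mtilde (y ∷ ys) + Mtilde (y ∷ ys)) ∎
    where
    G : List Bool
    G = gapGains ∞ y ys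

  peaksAfter-appendMax : ∀ l {x} y ys → All (_< x) (y ∷ ys) → peaksAfter l ((y ∷ ys) ++ [ x ]) ≡ peaksAfter l (y ∷ ys)
  peaksAfter-appendMax l {x} y [] (y<x ∷ [])
    rewrite <ᵇ-false (<⇒≤ y<x) | ∧-zeroʳ (l <∞ᵇ fin y) | ∧-zeroʳ (y <ᵇ x) = refl
  peaksAfter-appendMax l y (z ∷ zs) (_ ∷ below) = cong (bit (isPeak l y (z ∷ zs)) +_) (peaksAfter-appendMax (fin y) z zs below)

  allAbove-insertMax : ∀ {a x} → a < x → ∀ A C → allAbove a (A ++ x ∷ C) ≡ allAbove a (A ++ C)
  allAbove-insertMax a<x []      C rewrite <ᵇ-true a<x = refl
  allAbove-insertMax {a} a<x (b ∷ A) C = cong ((a <ᵇ b) ∧_) (allAbove-insertMax a<x A C)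

  rmi-insertMax : ∀ {x} A C → All (_< x) A → All (_< x) C → C ≢ [] → rmi (A ++ x ∷ C) ≡ rmi (A ++ C)
  rmi-insertMax []      []      _            _           C≢[] = ⊥-elim (C≢[] refl)
  rmi-insertMax []      (c ∷ C) _            (c<x ∷ _)   _    rewrite <ᵇ-false (<⇒≤ c<x) = refl
  rmi-insertMax (a ∷ A) C       (a<x ∷ A<x)  C<x         C≢[] rewrite allAbove-insertMax a<x A C =
    cong (bit (allAbove a (A ++ C)) +_) (rmi-insertMax A C A<x C<x C≢[])

  rmi-appendMax : ∀ {x} A → All (_< x) A → rmi (A ++ [ x ]) ≡ suc (rmi A)
  rmi-appendMax []      _           = refl
  rmi-appendMax (a ∷ A) (a<x ∷ A<x) rewrite allAbove-insertMax a<x A [] | ++-identityʳ A =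
    trans (cong (bit (allAbove a A) +_) (rmi-appendMax A A<x)) (+-suc _ _)

  rmi-positive : ∀ A → A ≢ [] → 0 < rmi A
  rmi-positive []          A≢[] = ⊥-elim (A≢[] refl)
  rmi-positive (a ∷ [])    _    = z<s
  rmi-positive (a ∷ b ∷ B) _    = <-≤-trans (rmi-positive (b ∷ B) (λ ())) (m≤n+m _ (bit (allAbove a (b ∷ B))))

  All-reverse : ∀ {P : ℕ → Set} A → All P A → All P (reverse A)
  All-reverse A = All-resp-↭ (↭-sym (↭-reverse A))

  reverse-≢[] : ∀ (A : List ℕ) → A ≢ [] → reverse A ≢ []
  reverse-≢[] A A≢[] rev≡[] = A≢[] (reverse-injective rev≡[])

  reverse-insert : ∀ (x : ℕ) A C → reverse (A ++ x ∷ C) ≡ reverse C ++ x ∷ reverse A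
  reverse-insert x A C = begin
    reverse (A ++ x ∷ C)              ≡⟨ reverse-++ A (x ∷ C) ⟩
    reverse (x ∷ C) ++ reverse A      ≡⟨ cong (_++ reverse A) (unfold-reverse x C) ⟩
    (reverse C ++ [ x ]) ++ reverse A ≡⟨ ++-assoc (reverse C) [ x ] (reverse A) ⟩
    reverse C ++ x ∷ reverse A        ∎

  lmi-insertMax : ∀ {x} A C → All (_< x) A → All (_< x) C → A ≢ [] → lmi (A ++ x ∷ C) ≡ lmi (A ++ C)
  lmi-insertMax {x} A C A<x C<x A≢[] = begin
    rmi (reverse (A ++ x ∷ C))       ≡⟨ cong rmi (reverse-insert x A C) ⟩
    rmi (reverse C ++ x ∷ reverse A) ≡⟨ rmi-insertMax (reverse C) (reverse A) (All-reverse C C<x) (All-reverse A A<x) (reverse-≢[] A A≢[]) ⟩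
    rmi (reverse C ++ reverse A)     ≡⟨ cong rmi (reverse-++ A C) ⟨
    rmi (reverse (A ++ C))           ∎

  lmi-prependMax : ∀ {x} A → All (_< x) A → lmi (x ∷ A) ≡ suc (lmi A)
  lmi-prependMax {x} A A<x = trans (cong rmi (unfold-reverse x A)) (rmi-appendMax (reverse A) (All-reverse A A<x))

  lmi-appendMax : ∀ {x} A → All (_< x) A → A ≢ [] → lmi (A ++ [ x ]) ≡ lmi A
  lmi-appendMax A A<x A≢[] = trans (lmi-insertMax A [] A<x [] A≢[]) (cong lmi (++-identityʳ A))

  lmi-positive : ∀ A → A ≢ [] → 0 < lmi A
  lmi-positive A A≢[] = rmi-positive (reverse A) (reverse-≢[] A A≢[])

  data InsertedNotLast (x : ℕ) : List ℕ → List ℕ → Set where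
    inserted : ∀ A c C → InsertedNotLast x (A ++ c ∷ C) (A ++ x ∷ c ∷ C)

  InsertedNotLast-∷ : ∀ {x ys t} z → InsertedNotLast x ys t → InsertedNotLast x (z ∷ ys) (z ∷ t)
  InsertedNotLast-∷ z (inserted A c C) = inserted (z ∷ A) c C

  insertNotLast-InsertedNotLast : ∀ x ys → All (InsertedNotLast x ys) (insertNotLast x ys)
  insertNotLast-InsertedNotLast x []       = []
  insertNotLast-InsertedNotLast x (z ∷ zs) =
    inserted [] z zs ∷ map⁺ (All.map (InsertedNotLast-∷ z) (insertNotLast-InsertedNotLast x zs))

  minima-InsertedNotLast : ∀ {x} y {ys t} → All (_< x) (y ∷ ys) → InsertedNotLast x ys t →
    lmi (y ∷ t) ≡ lmi (y ∷ ys) × rmi (y ∷ t) ≡ rmi (y ∷ ys)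
  minima-InsertedNotLast y (y<x ∷ ys<x) (inserted A c C) with ++⁻ A ys<x
  ... | A<x , C<x = lmi-insertMax (y ∷ A) (c ∷ C) (y<x ∷ A<x) C<x (λ ())
                  , rmi-insertMax (y ∷ A) (c ∷ C) (y<x ∷ A<x) C<x (λ ())

  minima-insertNotLast : ∀ {x} y ys → All (_< x) (y ∷ ys) →
    All (λ t → lmi (y ∷ t) ≡ lmi (y ∷ ys) × rmi (y ∷ t) ≡ rmi (y ∷ ys)) (insertNotLast x ys)
  minima-insertNotLast {x} y ys below = All.map (minima-InsertedNotLast y below) (insertNotLast-InsertedNotLast x ys)

  insertEverywhere-length : ∀ x σ {n} → length σ ≡ n → All (λ τ → length τ ≡ suc n) (insertEverywhere x σ)
  insertEverywhere-length x []       refl = refl ∷ []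
  insertEverywhere-length x (y ∷ ys) refl = refl ∷ map⁺ (All.map (cong suc) (insertEverywhere-length x ys refl))

  insertEverywhere-All : ∀ {P : ℕ → Set} {x} σ → P x → All P σ → All (All P) (insertEverywhere x σ)
  insertEverywhere-All []       px _          = (px ∷ []) ∷ []
  insertEverywhere-All (y ∷ ys) px (py ∷ ps) = (px ∷ py ∷ ps) ∷ map⁺ (All.map (py ∷_) (insertEverywhere-All ys px ps))

  𝔖-length : ∀ n → All (λ σ → length σ ≡ n) (𝔖 n)
  𝔖-length zero    = refl ∷ []
  𝔖-length (suc n) = concat⁺ (map⁺ (All.map (λ {σ} → insertEverywhere-length (suc n) σ) (𝔖-length n)))

  𝔖-bounded : ∀ n → All (All (_< suc n)) (𝔖 n)
  𝔖-bounded zero    = [] ∷ []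
  𝔖-bounded (suc n) = concat⁺ (map⁺ (All.map (λ {σ} σ≤n → insertEverywhere-All σ ≤-refl (All.map m≤n⇒m≤1+n σ≤n)) (𝔖-bounded n)))

module WeightedSums {c ℓ : Level} (R : CommutativeSemiring c ℓ) where
  open Insertion
  open CommutativeSemiring R
  open import Algebra.Definitions.RawSemiring rawSemiring public using (_^_; _×_)
  open import Algebra.Properties.Semiring.Exp semiring using (^-homo-*)
  open import Algebra.Properties.CommutativeSemigroup +-commutativeSemigroup using (interchange; x∙yz≈y∙xz)
  import Algebra.Properties.CommutativeSemigroup *-commutativeSemigroup as *-Comm
  open import Algebra.Solver.Ring.NaturalCoefficients.Default R using (solve; _:=_; _:+_; _:*_)
  open import Data.Bool using (Bool; true; false; if_then_else_)
  open import Data.Nat using (_<_)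
  open import Data.Nat.Properties using (+-suc)
  open import Data.List using (List; []; _∷_; [_]; _++_; map; concat; concatMap; filterᵇ; length)
  open import Data.List.Relation.Unary.All as All using (All; []; _∷_)
  open import Data.Product using (_,_)
  open import Relation.Binary.PropositionalEquality as ≡ using (_≡_; _≢_)
  open import Relation.Binary.Reasoning.Setoid setoid

  ∑ : {A : Set} → List A → (A → Carrier) → Carrier
  ∑ []       f = 0#
  ∑ (x ∷ xs) f = f x + ∑ xs f

  Σ[]≡∑ : ∀ σs f → Σ[_]_ R σs f ≡ ∑ σs f
  Σ[]≡∑ []       f = ≡.refl
  Σ[]≡∑ (σ ∷ σs) f = ≡.cong (f σ +_) (Σ[]≡∑ σs f)

  ∑-cong : {A : Set} {xs : List A} {f g : A → Carrier} → All (λ x → f x ≈ g x) xs → ∑ xs f ≈ ∑ xs g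
  ∑-cong []         = refl
  ∑-cong (fx≈gx ∷ ps) = +-cong fx≈gx (∑-cong ps)

  ∑-map : {A B : Set} (h : A → B) (xs : List A) (f : B → Carrier) → ∑ (map h xs) f ≡ ∑ xs (λ x → f (h x))
  ∑-map h []       f = ≡.refl
  ∑-map h (x ∷ xs) f = ≡.cong (f (h x) +_) (∑-map h xs f)

  ∑-++ : {A : Set} (xs ys : List A) (f : A → Carrier) → ∑ (xs ++ ys) f ≈ ∑ xs f + ∑ ys f
  ∑-++ []       ys f = sym (+-identityˡ _)
  ∑-++ (x ∷ xs) ys f = trans (+-congˡ (∑-++ xs ys f)) (sym (+-assoc _ _ _))

  ∑-concatMap : {A B : Set} (h : A → List B) (xs : List A) (f : B → Carrier) →
    ∑ (concatMap h xs) f ≈ ∑ xs (λ x → ∑ (h x) f)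
  ∑-concatMap h []       f = refl
  ∑-concatMap h (x ∷ xs) f = trans (∑-++ (h x) (concat (map h xs)) f) (+-congˡ (∑-concatMap h xs f))

  ∑-+ : {A : Set} (xs : List A) (f g : A → Carrier) → ∑ xs (λ x → f x + g x) ≈ ∑ xs f + ∑ xs g
  ∑-+ []       f g = sym (+-identityˡ _)
  ∑-+ (x ∷ xs) f g = trans (+-congˡ (∑-+ xs f g)) (interchange _ _ _ _)

  ∑-*ˡ : {A : Set} (a : Carrier) (xs : List A) (f : A → Carrier) → ∑ xs (λ x → a * f x) ≈ a * ∑ xs f
  ∑-*ˡ a []       f = sym (zeroʳ a)
  ∑-*ˡ a (x ∷ xs) f = trans (+-congˡ (∑-*ˡ a xs f)) (sym (distribˡ a _ _))

  ∑-*ʳ : {A : Set} (a : Carrier) (xs : List A) (f : A → Carrier) → ∑ xs (λ x → f x * a) ≈ ∑ xs f * a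
  ∑-*ʳ a []       f = sym (zeroˡ a)
  ∑-*ʳ a (x ∷ xs) f = trans (+-congˡ (∑-*ʳ a xs f)) (sym (distribʳ a _ _))

  indicator : Bool → Carrier
  indicator b = if b then 1# else 0#

  ∑-filterᵇ : {A : Set} (p : A → Bool) (xs : List A) (f : A → Carrier) →
    ∑ (filterᵇ p xs) f ≈ ∑ xs (λ x → indicator (p x) * f x)
  ∑-filterᵇ p []       f = refl
  ∑-filterᵇ p (x ∷ xs) f with p x
  ... | true  = +-cong (sym (*-identityˡ (f x))) (∑-filterᵇ p xs f)
  ... | false = trans (∑-filterᵇ p xs f) (sym (trans (+-congʳ (zeroˡ (f x))) (+-identityˡ _)))

  ∑-bits : (f : ℕ → Carrier) (m : ℕ) (bs : List Bool) → ∑ bs (λ b → f (bit b +ℕ m)) ≈ trues bs × f (suc m) + falses bs × f m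
  ∑-bits f m []           = sym (+-identityˡ _)
  ∑-bits f m (true ∷ bs)  = trans (+-congˡ (∑-bits f m bs)) (sym (+-assoc _ _ _))
  ∑-bits f m (false ∷ bs) = trans (+-congˡ (∑-bits f m bs)) (x∙yz≈y∙xz _ _ _)

  ^-pred : ∀ u {n} → 0 < n → u ^ n ≡ u * u ^ (n ∸ 1)
  ^-pred u {suc n} _ = ≡.refl

  minimaWeight : Carrier → Carrier → List ℕ → Carrier
  minimaWeight u v σ = u ^ (lmi σ ∸ 1) * v ^ (rmi σ ∸ 1)

  minimaWeight-prependMax : ∀ u v {x} σ → All (_< x) σ → σ ≢ [] → minimaWeight u v (x ∷ σ) ≈ u * minimaWeight u v σ
  minimaWeight-prependMax u v σ σ<x σ≢[] = begin
    minimaWeight u v (_ ∷ σ)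
      ≡⟨ ≡.cong₂ (λ i j → u ^ (i ∸ 1) * v ^ (j ∸ 1)) (lmi-prependMax σ σ<x) (rmi-insertMax [] σ [] σ<x σ≢[]) ⟩
    u ^ lmi σ * v ^ (rmi σ ∸ 1)              ≡⟨ ≡.cong (_* v ^ (rmi σ ∸ 1)) (^-pred u (lmi-positive σ σ≢[])) ⟩
    (u * u ^ (lmi σ ∸ 1)) * v ^ (rmi σ ∸ 1)  ≈⟨ *-assoc _ _ _ ⟩
    u * minimaWeight u v σ                   ∎

  minimaWeight-appendMax : ∀ u v {x} σ → All (_< x) σ → σ ≢ [] → minimaWeight u v (σ ++ [ x ]) ≈ v * minimaWeight u v σ
  minimaWeight-appendMax u v σ σ<x σ≢[] = begin
    minimaWeight u v (σ ++ [ _ ])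
      ≡⟨ ≡.cong₂ (λ i j → u ^ (i ∸ 1) * v ^ (j ∸ 1)) (lmi-appendMax σ σ<x σ≢[]) (rmi-appendMax σ σ<x) ⟩
    u ^ (lmi σ ∸ 1) * v ^ rmi σ              ≡⟨ ≡.cong (u ^ (lmi σ ∸ 1) *_) (^-pred v (rmi-positive σ σ≢[])) ⟩
    u ^ (lmi σ ∸ 1) * (v * v ^ (rmi σ ∸ 1))  ≈⟨ *-Comm.x∙yz≈y∙xz _ _ _ ⟩
    v * minimaWeight u v σ                   ∎

  minimaWeight-diagonal : ∀ s σ → σ ≢ [] → minimaWeight s s σ ≈ s ^ (lmi σ +ℕ rmi σ ∸ 2)
  minimaWeight-diagonal s σ σ≢[] = begin
    s ^ (lmi σ ∸ 1) * s ^ (rmi σ ∸ 1)  ≈⟨ ^-homo-* s (lmi σ ∸ 1) (rmi σ ∸ 1) ⟨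
    s ^ ((lmi σ ∸ 1) +ℕ (rmi σ ∸ 1))   ≡⟨ ≡.cong (s ^_) (pred+pred (lmi-positive σ σ≢[]) (rmi-positive σ σ≢[])) ⟩
    s ^ (lmi σ +ℕ rmi σ ∸ 2)           ∎
    where
    pred+pred : ∀ {a b} → 0 < a → 0 < b → (a ∸ 1) +ℕ (b ∸ 1) ≡ a +ℕ b ∸ 2
    pred+pred {suc a} {suc b} _ _ = ≡.cong (_∸ 1) (≡.sym (+-suc a b))

  peakWeight : (ℕ → Carrier) → Carrier → Carrier → List ℕ → Carrier
  peakWeight f u v σ = f (Mtilde σ) * minimaWeight u v σ

  weightedSum : ℕ → (ℕ → Carrier) → Carrier → Carrier → Carrier
  weightedSum n f u v = ∑ (𝔖 n) (peakWeight f u v)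

  -- A permutation of length g + 1 with m peaks has g interior gaps, 2m of them next to a peak.
  insertCoeff : ℕ → (ℕ → Carrier) → ℕ → Carrier
  insertCoeff g f m = (g ∸ (m +ℕ m)) × f (suc m) + (m +ℕ m) × f m

  ∑-peaks-insertNotLast : ∀ f {x} y ys → All (_< x) (y ∷ ys) →
    ∑ (insertNotLast x ys) (λ t → f (Mtilde (y ∷ t))) ≈ insertCoeff (length ys) f (Mtilde (y ∷ ys))
  ∑-peaks-insertNotLast f {x} y ys below = begin
    ∑ L (λ t → f (Mtilde (y ∷ t)))         ≡⟨ ∑-map (λ t → Mtilde (y ∷ t)) L f ⟨
    ∑ (map (λ t → Mtilde (y ∷ t)) L) f     ≡⟨ ≡.cong (λ ms → ∑ ms f) (peaksAfter-insertNotLast ∞ y ys below) ⟩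
    ∑ (map (λ g → bit g +ℕ m) G) f         ≡⟨ ∑-map (λ g → bit g +ℕ m) G f ⟩
    ∑ G (λ g → f (bit g +ℕ m))             ≈⟨ ∑-bits f m G ⟩
    trues G × f (suc m) + falses G × f m
      ≡⟨ ≡.cong₂ (λ i j → i × f (suc m) + j × f m) (trues-gapGains y ys) (falses-gapGains ∞ y ys) ⟩
    insertCoeff (length ys) f m            ∎
    where
    L : List (List ℕ)
    L = insertNotLast x ys
    G : List Bool
    G = gapGains ∞ y ys
    m : ℕ
    m = Mtilde (y ∷ ys)

  ∑-peakWeight-insertNotLast : ∀ f u v {x} y ys → All (_< x) (y ∷ ys) →
    ∑ (map (y ∷_) (insertNotLast x ys)) (peakWeight f u v) ≈ insertCoeff (length ys) f (Mtilde (y ∷ ys)) * minimaWeight u v (y ∷ ys)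
  ∑-peakWeight-insertNotLast f u v {x} y ys below = begin
    ∑ (map (y ∷_) L) (peakWeight f u v)                         ≡⟨ ∑-map (y ∷_) L (peakWeight f u v) ⟩
    ∑ L (λ t → f (Mtilde (y ∷ t)) * minimaWeight u v (y ∷ t))
      ≈⟨ ∑-cong (All.map (λ {t} (lmi≡ , rmi≡) → sameWeight {t} lmi≡ rmi≡) (minima-insertNotLast y ys below)) ⟩
    ∑ L (λ t → f (Mtilde (y ∷ t)) * W)                          ≈⟨ ∑-*ʳ W L _ ⟩
    ∑ L (λ t → f (Mtilde (y ∷ t))) * W                          ≈⟨ *-congʳ (∑-peaks-insertNotLast f y ys below) ⟩
    insertCoeff (length ys) f (Mtilde (y ∷ ys)) * W             ∎
    where
    L : List (List ℕ)
    L = insertNotLast x ys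
    W : Carrier
    W = minimaWeight u v (y ∷ ys)
    sameWeight : ∀ {t} → lmi (y ∷ t) ≡ lmi (y ∷ ys) → rmi (y ∷ t) ≡ rmi (y ∷ ys) →
                 f (Mtilde (y ∷ t)) * minimaWeight u v (y ∷ t) ≈ f (Mtilde (y ∷ t)) * W
    sameWeight lmi≡ rmi≡ = *-congˡ (reflexive (≡.cong₂ (λ i j → u ^ (i ∸ 1) * v ^ (j ∸ 1)) lmi≡ rmi≡))

  ∑-insertEverywhere : ∀ f u v {x n} σ → length σ ≡ suc n → All (_< x) σ →
    ∑ (insertEverywhere x σ) (peakWeight f u v) ≈ (u + v) * peakWeight f u v σ + peakWeight (insertCoeff n f) u v σ
  ∑-insertEverywhere f u v {x} (y ∷ ys) ≡.refl below@(y<x ∷ _) = begin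
    ∑ (insertEverywhere x σ) P
      ≡⟨ ≡.cong (λ τs → ∑ τs P) (insertEverywhere-insertNotLast x σ) ⟩
    ∑ (insertNotLast x σ ++ [ σ ++ [ x ] ]) P
      ≈⟨ ∑-++ (insertNotLast x σ) _ P ⟩
    (P (x ∷ σ) + ∑ (map (y ∷_) (insertNotLast x ys)) P) + (P (σ ++ [ x ]) + 0#)
      ≈⟨ +-cong (+-cong atFront (∑-peakWeight-insertNotLast f u v y ys below)) (trans (+-identityʳ _) atBack) ⟩
    (f m * (u * W) + K * W) + f m * (v * W)
      ≈⟨ solve 5 (λ a u v W K → (a :* (u :* W) :+ K :* W) :+ a :* (v :* W) := (u :+ v) :* (a :* W) :+ K :* W) refl (f m) u v W K ⟩
    (u + v) * (f m * W) + K * W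
      ∎
    where
    σ : List ℕ
    σ = y ∷ ys
    P : List ℕ → Carrier
    P = peakWeight f u v
    m : ℕ
    m = Mtilde σ
    W K : Carrier
    W = minimaWeight u v σ
    K = insertCoeff (length ys) f m
    atFront : P (x ∷ σ) ≈ f m * (u * W)
    atFront = *-cong (reflexive (≡.cong f (peaksAfter-larger ys y<x))) (minimaWeight-prependMax u v σ below λ ())
    atBack : P (σ ++ [ x ]) ≈ f m * (v * W)
    atBack = *-cong (reflexive (≡.cong f (peaksAfter-appendMax ∞ y ys below))) (minimaWeight-appendMax u v σ below λ ())

  weightedSum-suc : ∀ n f u v →
    weightedSum (suc (suc n)) f u v ≈ (u + v) * weightedSum (suc n) f u v + weightedSum (suc n) (insertCoeff n f) u v
  weightedSum-suc n f u v = begin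
    ∑ (concatMap (insertEverywhere (suc (suc n))) (𝔖 (suc n))) P   ≈⟨ ∑-concatMap _ (𝔖 (suc n)) P ⟩
    ∑ (𝔖 (suc n)) (λ σ → ∑ (insertEverywhere (suc (suc n)) σ) P)
      ≈⟨ ∑-cong (All.zipWith (λ (length≡ , below) → ∑-insertEverywhere f u v _ length≡ below) (𝔖-length (suc n) , 𝔖-bounded (suc n))) ⟩
    ∑ (𝔖 (suc n)) (λ σ → (u + v) * P σ + P′ σ)                    ≈⟨ ∑-+ (𝔖 (suc n)) _ P′ ⟩
    ∑ (𝔖 (suc n)) (λ σ → (u + v) * P σ) + ∑ (𝔖 (suc n)) P′        ≈⟨ +-congʳ (∑-*ˡ (u + v) (𝔖 (suc n)) P) ⟩
    (u + v) * ∑ (𝔖 (suc n)) P + ∑ (𝔖 (suc n)) P′                  ∎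
    where
    P P′ : List ℕ → Carrier
    P = peakWeight f u v
    P′ = peakWeight (insertCoeff n f) u v

  weightedSum-cong-+ : ∀ n f {u v u′ v′} → u + v ≈ u′ + v′ → weightedSum n f u v ≈ weightedSum n f u′ v′
  weightedSum-cong-+ zero          f _ = refl
  weightedSum-cong-+ (suc zero)    f _ = refl
  weightedSum-cong-+ (suc (suc n)) f {u} {v} {u′} {v′} u+v≈u′+v′ = begin
    weightedSum (suc (suc n)) f u v                                              ≈⟨ weightedSum-suc n f u v ⟩
    (u + v) * weightedSum (suc n) f u v + weightedSum (suc n) (insertCoeff n f) u v
      ≈⟨ +-cong (*-cong u+v≈u′+v′ (weightedSum-cong-+ (suc n) f u+v≈u′+v′)) (weightedSum-cong-+ (suc n) (insertCoeff n f) u+v≈u′+v′) ⟩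
    (u′ + v′) * weightedSum (suc n) f u′ v′ + weightedSum (suc n) (insertCoeff n f) u′ v′ ≈⟨ weightedSum-suc n f u′ v′ ⟨
    weightedSum (suc (suc n)) f u′ v′                                            ∎

  weightedSum-diagonal : ∀ n f s → weightedSum (suc n) f s s ≈ ∑ (𝔖 (suc n)) (λ σ → f (Mtilde σ) * s ^ (lmi σ +ℕ rmi σ ∸ 2))
  weightedSum-diagonal n f s = ∑-cong (All.map (λ {σ} length≡ → *-congˡ (minimaWeight-diagonal s σ (nonempty length≡))) (𝔖-length (suc n)))
    where
    nonempty : ∀ {σ : List ℕ} → length σ ≡ suc n → σ ≢ []
    nonempty {[]}    ()
    nonempty {_ ∷ _} _ ()

  ∑-𝒫 : ∀ n k g → ∑ (𝒫 n k) g ≈ ∑ (𝔖 n) (λ σ → indicator (Mtilde σ ≡ᵇ k) * g σ)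
  ∑-𝒫 n k = ∑-filterᵇ _ (𝔖 n)

theorem1p6 : ∀ {c ℓ} (R : CommutativeSemiring c ℓ) (n k : ℕ) → n ≥ 1 →
    (α β : CommutativeSemiring.Carrier R) →
    CommutativeSemiring._≈_ R (lhsSum R n k α β) (rhsSum R n k α β)
theorem1p6 R zero    k () α β
theorem1p6 R (suc n) k _  α β = begin
  lhsSum R (suc n) k α β                                              ≡⟨ Σ[]≡∑ (𝒫 (suc n) k) _ ⟩
  ∑ (𝒫 (suc n) k) (minimaWeight (α + α) (β + β))                      ≈⟨ ∑-𝒫 (suc n) k _ ⟩
  weightedSum (suc n) [≡ k ] (α + α) (β + β)                          ≈⟨ weightedSum-cong-+ (suc n) [≡ k ] (interchange α α β β) ⟩
  weightedSum (suc n) [≡ k ] (α + β) (α + β)                          ≈⟨ weightedSum-diagonal n [≡ k ] (α + β) ⟩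
  ∑ (𝔖 (suc n)) (λ σ → [≡ k ] (Mtilde σ) * (α + β) ^ (lmi σ +ℕ rmi σ ∸ 2)) ≈⟨ ∑-𝒫 (suc n) k _ ⟨
  ∑ (𝒫 (suc n) k) (λ σ → (α + β) ^ (lmi σ +ℕ rmi σ ∸ 2))              ≡⟨ Σ[]≡∑ (𝒫 (suc n) k) _ ⟨
  rhsSum R (suc n) k α β                                              ∎
  where
  open CommutativeSemiring R
  open WeightedSums R
  open CommutativeSemigroupProperties +-commutativeSemigroup using (interchange)
  open SetoidReasoning setoid
  [≡_] : ℕ → ℕ → Carrier
  [≡ j ] m = indicator (m ≡ᵇ j)
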